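{- Let $G$ be a group with normal subgroups $G_1$ and $G_2$ such that $G/G_i$ is finite and abelian for $i=1,2$. Let $\alpha$ be an automorphism of $G$ such that $\alpha(G_i)\subset G_i$ for $i=1,2$. Suppose that $\alpha$ acts trivially on $G/G_1$ and acts on $G/G_2$ as the scalar $m$ (i.e. $\alpha(xG_2)=x^mG_2$ for all $x\in G$), where $m$ is an integer such that $m-1$ is prime to the order of $G/G_2$. Then every coset of $G_1$ in $G$ meets every coset of $G_2$ in $G$. -}

module Defs where

open import Level using (Level; _⊔_; suc)
open import Algebra.Bundles using (Group)
open import Data.Nat using (ℕ) renaming (zero to nzero; suc to nsuc)
open import Data.Integer using (ℤ; +_; -[1+_])
open import Data.Fin using (Fin)
open import Data.Product using (∃; _×_)
open import Relation.Binary.PropositionalEquality using (_≡_)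

module _ {c ℓ : Level} (G : Group c ℓ) where
  open Group G

  npow : Carrier → ℕ → Carrier
  npow x nzero = ε
  npow x (nsuc n) = x ∙ npow x n

  zpow : Carrier → ℤ → Carrier
  zpow x (+ n) = npow x n
  zpow x -[1+ n ] = (npow x (nsuc n)) ⁻¹

  record IsSubgroup {p : Level} (N : Carrier → Set p) : Set (c ⊔ ℓ ⊔ p) where
    field
      resp    : ∀ {x y} → x ≈ y → N x → N y
      ε-mem   : N ε
      ∙-mem   : ∀ {x y} → N x → N y → N (x ∙ y)
      ⁻¹-mem  : ∀ {x} → N x → N (x ⁻¹)

  record IsNormalSubgroup {p : Level} (N : Carrier → Set p) : Set (c ⊔ ℓ ⊔ p) where
    field
      isSubgroup : IsSubgroup N
      conj       : ∀ g x → N x → N ((g ∙ x) ∙ g ⁻¹)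

  -- G/N has exactly n elements: a complete, irredundant system of
  -- left coset representatives rep : Fin n → G  (xN = yN iff x⁻¹y ∈ N)
  record CosetReps {p : Level} (N : Carrier → Set p) (n : ℕ) : Set (c ⊔ p) where
    field
      rep      : Fin n → Carrier
      covers   : ∀ x → ∃ λ i → N (rep i ⁻¹ ∙ x)
      distinct : ∀ i j → N (rep i ⁻¹ ∙ rep j) → i ≡ j

  FiniteQuotient : {p : Level} → (Carrier → Set p) → Set (c ⊔ p)
  FiniteQuotient N = ∃ λ n → CosetReps N n

  AbelianQuotient : {p : Level} → (Carrier → Set p) → Set (c ⊔ p)
  AbelianQuotient N = ∀ x y → N (((x ∙ y) ∙ x ⁻¹) ∙ y ⁻¹)

  record IsAutomorphism (α : Carrier → Carrier) : Set (c ⊔ ℓ) where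
    field
      cong     : ∀ {x y} → x ≈ y → α x ≈ α y
      hom      : ∀ x y → α (x ∙ y) ≈ α x ∙ α y
      injective  : ∀ {x y} → α x ≈ α y → x ≈ y
      surjective : ∀ y → ∃ λ x → α x ≈ y

{-# OPTIONS --safe #-}
-- G/G₂ is an abelian group with n elements, so n·x = ε in it (translation by x
-- permutes the cosets, so their product P satisfies P = (n·x)P), and as
-- m − 1 is prime to n, Bézout makes every class of G/G₂ an (m − 1)-th power
-- g^(m−1).  Modulo G₂ we have α g ≡ g^m, so g⁻¹ α g represents that class, and it
-- lies in G₁ because α is trivial on G/G₁.  Hence G₁ meets every coset of G₂, and
-- for h ∈ G₁ with h ≡ x⁻¹y mod G₂ the element xh lies in xG₁ ∩ yG₂.
module Submission where

open import Defs
open import Level using (Level)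
open import Algebra.Bundles using (Group)
open import Data.Nat using (ℕ)
open import Data.Integer using (ℤ; ∣_∣; _-_; 1ℤ)
open import Data.Nat.Coprimality using (Coprime)
open import Data.Product using (∃; _×_)

open import Algebra.Bundles using (AbelianGroup)
open import Data.Fin using (Fin)
open import Data.Fin.Permutation using (Permutation; permutation)
open import Data.Integer using (+_; -[1+_])
open import Data.Nat using (zero; suc; _+_; _*_)
open import Data.Nat.Coprimality using (coprime-Bézout)
open import Data.Nat.GCD using (module Bézout)
import Data.Nat.Properties as ℕ
open import Data.Product using (_,_; proj₁; proj₂; map₂)
open import Relation.Binary.Bundles using (Setoid)
open import Relation.Binary.Core using (Rel)
open import Relation.Binary.PropositionalEquality as ≡ using (_≡_)
import Relation.Binary.Reasoning.Setoid as SetoidReasoning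

module AbelianGroupProperties {a ℓ} (A : AbelianGroup a ℓ) where
  open AbelianGroup A hiding (_-_)
  open import Algebra.Properties.AbelianGroup A
  open import Algebra.Properties.CommutativeMonoid.Sum commutativeMonoid
  open import Algebra.Properties.Monoid.Mult monoid renaming (_×_ to _·_)
  open SetoidReasoning setoid

  order·≈ε : ∀ {n} (rep : Fin n → Carrier) →
             (∀ x → ∃ λ i → rep i ≈ x) → (∀ i j → rep i ≈ rep j → i ≡ j) →
             ∀ x → n · x ≈ ε
  order·≈ε {n} rep onto distinct x = identityˡ-unique (n · x) (sum rep) (sym (begin
    sum rep                           ≈⟨ ∑-permute rep translation ⟩
    sum {n} (λ i → rep (shift x i))   ≈⟨ sum-cong-≋ {n} (rep-shift x) ⟩
    sum {n} (λ i → x ∙ rep i)         ≈⟨ ∑-distrib-+ (λ _ → x) rep ⟩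
    sum {n} (λ _ → x) ∙ sum rep       ≈⟨ ∙-congʳ (sum-replicate n) ⟩
    n · x ∙ sum rep                   ∎))
    where
    shift : Carrier → Fin n → Fin n
    shift y i = proj₁ (onto (y ∙ rep i))

    rep-shift : ∀ y i → rep (shift y i) ≈ y ∙ rep i
    rep-shift y i = proj₂ (onto (y ∙ rep i))

    shift-cancel : ∀ y z i → z ∙ (y ∙ rep i) ≈ rep i → shift z (shift y i) ≡ i
    shift-cancel y z i zyr≈r =
      distinct _ _ (trans (rep-shift z _) (trans (∙-congˡ (rep-shift y i)) zyr≈r))

    translation : Permutation n n
    translation = permutation (shift x) (shift (x ⁻¹))
      (λ i → shift-cancel (x ⁻¹) x i (\\-leftDividesˡ x (rep i)))
      (λ i → shift-cancel x (x ⁻¹) i (\\-leftDividesʳ x (rep i)))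

  multiple·≈ε : ∀ {n} → (∀ x → n · x ≈ ε) → ∀ b x → (b * n) · x ≈ ε
  multiple·≈ε {n} n·≈ε b x = begin
    (b * n) · x  ≡⟨ ≡.cong (_· x) (ℕ.*-comm b n) ⟩
    (n * b) · x  ≈⟨ ×-assocˡ x n b ⟨
    n · (b · x)  ≈⟨ n·≈ε (b · x) ⟩
    ε            ∎

  ·-surjective : ∀ {n k} → (∀ x → n · x ≈ ε) → Coprime k n → ∀ w → ∃ λ g → k · g ≈ w
  ·-surjective {n} {k} n·≈ε k⊥n w with coprime-Bézout k⊥n
  ... | Bézout.+- a b 1+bn≡ak = a · w , (begin
    k · (a · w)      ≈⟨ ×-assocˡ w k a ⟩
    (k * a) · w      ≡⟨ ≡.cong (_· w) (≡.trans (ℕ.*-comm k a) (≡.sym 1+bn≡ak)) ⟩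
    w ∙ (b * n) · w  ≈⟨ ∙-congˡ (multiple·≈ε n·≈ε b w) ⟩
    w ∙ ε            ≈⟨ identityʳ w ⟩
    w                ∎)
  ... | Bézout.-+ a b 1+ak≡bn = a · (w ⁻¹) , (begin
    k · (a · (w ⁻¹))  ≈⟨ ×-assocˡ (w ⁻¹) k a ⟩
    (k * a) · (w ⁻¹)  ≈⟨ inverseʳ-unique (w ⁻¹) _ w⁻¹∙ka·w⁻¹≈ε ⟩
    w ⁻¹ ⁻¹           ≈⟨ ⁻¹-involutive w ⟩
    w                 ∎)
    where
    w⁻¹∙ka·w⁻¹≈ε : w ⁻¹ ∙ (k * a) · (w ⁻¹) ≈ ε
    w⁻¹∙ka·w⁻¹≈ε = begin
      w ⁻¹ ∙ (k * a) · (w ⁻¹)  ≡⟨ ≡.cong (λ t → (1 + t) · (w ⁻¹)) (ℕ.*-comm k a) ⟩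
      (1 + a * k) · (w ⁻¹)     ≡⟨ ≡.cong (_· (w ⁻¹)) 1+ak≡bn ⟩
      (b * n) · (w ⁻¹)         ≈⟨ multiple·≈ε n·≈ε b (w ⁻¹) ⟩
      ε                        ∎

  npow≡· : ∀ g k → npow group g k ≡ k · g
  npow≡· g zero    = ≡.refl
  npow≡· g (suc k) = ≡.cong (g ∙_) (npow≡· g k)

  zpow-surjective : ∀ {n} → (∀ x → n · x ≈ ε) →
                    ∀ k → Coprime ∣ k ∣ n → ∀ w → ∃ λ g → zpow group g k ≈ w
  zpow-surjective n·≈ε (+ j) j⊥n w =
    map₂ (λ {g} j·g≈w → trans (reflexive (npow≡· g j)) j·g≈w) (·-surjective n·≈ε j⊥n w)
  zpow-surjective n·≈ε -[1+ j ] j⊥n w =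
    map₂ (λ {g} j·g≈w⁻¹ →
            trans (⁻¹-cong (trans (reflexive (npow≡· g (suc j))) j·g≈w⁻¹)) (⁻¹-involutive w))
         (·-surjective n·≈ε j⊥n (w ⁻¹))

  zpow-pred : ∀ g m → g ⁻¹ ∙ zpow group g m ≈ zpow group g (m - 1ℤ)
  zpow-pred g (+ zero)  = trans (identityʳ (g ⁻¹)) (⁻¹-cong (sym (identityʳ g)))
  zpow-pred g (+ suc j) = \\-leftDividesʳ g (npow group g j)
  zpow-pred g -[1+ j ]  = begin
    g ⁻¹ ∙ (g ∙ npow group g j) ⁻¹  ≈⟨ ⁻¹-∙-comm g _ ⟩
    (g ∙ (g ∙ npow group g j)) ⁻¹   ≡⟨ ≡.cong (λ i → zpow group g -[1+ suc i ])
                                                (≡.sym (ℕ.+-identityʳ j)) ⟩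
    zpow group g (-[1+ j ] - 1ℤ)    ∎

module LeftCosets {c ℓ p} (G : Group c ℓ) {N : Group.Carrier G → Set p} (N≤G : IsSubgroup G N) where
  open Group G
  open IsSubgroup N≤G
  open import Algebra.Properties.Group G

  infix 4 _≈ᴺ_
  _≈ᴺ_ : Rel Carrier p
  x ≈ᴺ y = N (x ⁻¹ ∙ y)

  ≈⇒≈ᴺ : ∀ {x y} → x ≈ y → x ≈ᴺ y
  ≈⇒≈ᴺ {x} x≈y = resp (trans (sym (inverseˡ x)) (∙-congˡ x≈y)) ε-mem

  ≈ᴺ-sym : ∀ {x y} → x ≈ᴺ y → y ≈ᴺ x
  ≈ᴺ-sym {x} {y} x≈ᴺy =
    resp (trans (⁻¹-anti-homo-∙ (x ⁻¹) y) (∙-congˡ (⁻¹-involutive x))) (⁻¹-mem x≈ᴺy)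

  ≈ᴺ-trans : ∀ {x y z} → x ≈ᴺ y → y ≈ᴺ z → x ≈ᴺ z
  ≈ᴺ-trans {x} {y} {z} x≈ᴺy y≈ᴺz =
    resp (trans (assoc (x ⁻¹) y (y ⁻¹ ∙ z)) (∙-congˡ (\\-leftDividesˡ y z))) (∙-mem x≈ᴺy y≈ᴺz)

  ≈ᴺ-setoid : Setoid c p
  ≈ᴺ-setoid = record
    { _≈_ = _≈ᴺ_
    ; isEquivalence = record { refl = ≈⇒≈ᴺ refl ; sym = ≈ᴺ-sym ; trans = ≈ᴺ-trans }
    }

  ∙-congˡᴺ : ∀ {x y z} → x ≈ᴺ y → z ∙ x ≈ᴺ z ∙ y
  ∙-congˡᴺ {x} {y} {z} = resp (sym (begin
    (z ∙ x) ⁻¹ ∙ (z ∙ y)      ≈⟨ ∙-congʳ (⁻¹-anti-homo-∙ z x) ⟩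
    x ⁻¹ ∙ z ⁻¹ ∙ (z ∙ y)     ≈⟨ assoc (x ⁻¹) (z ⁻¹) (z ∙ y) ⟩
    x ⁻¹ ∙ (z ⁻¹ ∙ (z ∙ y))   ≈⟨ ∙-congˡ (\\-leftDividesʳ z y) ⟩
    x ⁻¹ ∙ y                  ∎))
    where open SetoidReasoning setoid

  cosets-meet : ∀ {q} {H : Carrier → Set q} → (∀ {x y} → x ≈ y → H x → H y) →
                (∀ w → ∃ λ h → H h × h ≈ᴺ w) →
                ∀ x y → ∃ λ z → H (x ⁻¹ ∙ z) × N (y ⁻¹ ∙ z)
  cosets-meet H-resp H-onto x y with H-onto (x ⁻¹ ∙ y)
  ... | h , h∈H , h≈ᴺx⁻¹y = x ∙ h
      , H-resp (sym (\\-leftDividesʳ x h)) h∈H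
      , ≈ᴺ-sym (≈ᴺ-trans (∙-congˡᴺ h≈ᴺx⁻¹y) (≈⇒≈ᴺ (\\-leftDividesˡ x y)))

module QuotientAbelianGroup {c ℓ p} (G : Group c ℓ) {N : Group.Carrier G → Set p}
                            (N≤G : IsSubgroup G N) (G/N-abelian : AbelianQuotient G N) where
  open Group G
  open IsSubgroup N≤G
  open import Algebra.Properties.Group G
  open LeftCosets G N≤G public

  ∙-commᴺ : ∀ x y → x ∙ y ≈ᴺ y ∙ x
  ∙-commᴺ x y = resp (begin
    y ⁻¹ ∙ x ⁻¹ ∙ y ⁻¹ ⁻¹ ∙ x ⁻¹ ⁻¹  ≈⟨ ∙-cong (∙-congˡ (⁻¹-involutive y)) (⁻¹-involutive x) ⟩
    y ⁻¹ ∙ x ⁻¹ ∙ y ∙ x              ≈⟨ assoc (y ⁻¹ ∙ x ⁻¹) y x ⟩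
    y ⁻¹ ∙ x ⁻¹ ∙ (y ∙ x)            ≈⟨ ∙-congʳ (⁻¹-anti-homo-∙ x y) ⟨
    (x ∙ y) ⁻¹ ∙ (y ∙ x)             ∎) (G/N-abelian (y ⁻¹) (x ⁻¹))
    where open SetoidReasoning setoid

  ∙-congʳᴺ : ∀ {x y z} → x ≈ᴺ y → x ∙ z ≈ᴺ y ∙ z
  ∙-congʳᴺ {x} {y} {z} x≈ᴺy = ≈ᴺ-trans (∙-commᴺ x z) (≈ᴺ-trans (∙-congˡᴺ x≈ᴺy) (∙-commᴺ z y))

  ∙-congᴺ : ∀ {x x′ y y′} → x ≈ᴺ x′ → y ≈ᴺ y′ → x ∙ y ≈ᴺ x′ ∙ y′
  ∙-congᴺ x≈ᴺx′ y≈ᴺy′ = ≈ᴺ-trans (∙-congʳᴺ x≈ᴺx′) (∙-congˡᴺ y≈ᴺy′)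

  ⁻¹-congᴺ : ∀ {x y} → x ≈ᴺ y → x ⁻¹ ≈ᴺ y ⁻¹
  ⁻¹-congᴺ {x} {y} x≈ᴺy = begin
    x ⁻¹                 ≈⟨ ≈⇒≈ᴺ (\\-leftDividesʳ y (x ⁻¹)) ⟨
    y ⁻¹ ∙ (y ∙ x ⁻¹)    ≈⟨ ∙-congˡᴺ (∙-congʳᴺ (≈ᴺ-sym x≈ᴺy)) ⟩
    y ⁻¹ ∙ (x ∙ x ⁻¹)    ≈⟨ ≈⇒≈ᴺ (trans (∙-congˡ (inverseʳ x)) (identityʳ (y ⁻¹))) ⟩
    y ⁻¹                 ∎
    where open SetoidReasoning ≈ᴺ-setoid

  quotient : AbelianGroup c p
  quotient = record
    { _≈_ = _≈ᴺ_
    ; _∙_ = _∙_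
    ; ε = ε
    ; _⁻¹ = _⁻¹
    ; isAbelianGroup = record
      { isGroup = record
        { isMonoid = record
          { isSemigroup = record
            { isMagma = record
              { isEquivalence = Setoid.isEquivalence ≈ᴺ-setoid
              ; ∙-cong = ∙-congᴺ
              }
            ; assoc = λ x y z → ≈⇒≈ᴺ (assoc x y z)
            }
          ; identity = (λ x → ≈⇒≈ᴺ (identityˡ x)) , (λ x → ≈⇒≈ᴺ (identityʳ x))
          }
        ; inverse = (λ x → ≈⇒≈ᴺ (inverseˡ x)) , (λ x → ≈⇒≈ᴺ (inverseʳ x))
        ; ⁻¹-cong = ⁻¹-congᴺ
        }
      ; comm = ∙-commᴺ
      }
    }

  npow-quotient : ∀ g k → npow G g k ≡ npow (AbelianGroup.group quotient) g k
  npow-quotient g zero    = ≡.refl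
  npow-quotient g (suc k) = ≡.cong (g ∙_) (npow-quotient g k)

  zpow-quotient : ∀ g m → zpow G g m ≡ zpow (AbelianGroup.group quotient) g m
  zpow-quotient g (+ k)    = npow-quotient g k
  zpow-quotient g -[1+ k ] = ≡.cong _⁻¹ (npow-quotient g (suc k))

lemma4 : ∀ {c ℓ p₁ p₂ : Level} (G : Group c ℓ) →
  (G₁ : Group.Carrier G → Set p₁) (G₂ : Group.Carrier G → Set p₂) →
  IsNormalSubgroup G G₁ → IsNormalSubgroup G G₂ →
  FiniteQuotient G G₁ → AbelianQuotient G G₁ →
  AbelianQuotient G G₂ →
  (α : Group.Carrier G → Group.Carrier G) → IsAutomorphism G α →
  (∀ x → G₁ x → G₁ (α x)) → (∀ x → G₂ x → G₂ (α x)) →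
  (∀ x → G₁ (Group._∙_ G (Group._⁻¹ G x) (α x))) →
  (m : ℤ) → (∀ x → G₂ (Group._∙_ G (Group._⁻¹ G (zpow G x m)) (α x))) →
  (n : ℕ) → CosetReps G G₂ n → Coprime ∣ m - 1ℤ ∣ n →
  ∀ x y → ∃ λ z → G₁ (Group._∙_ G (Group._⁻¹ G x) z) × G₂ (Group._∙_ G (Group._⁻¹ G y) z)
lemma4 G G₁ G₂ G₁◁G G₂◁G _ _ G/G₂-abelian α _ _ _ α-trivial-mod-G₁ m α-power-mod-G₂ n reps m-1⊥n =
  cosets-meet (IsSubgroup.resp (IsNormalSubgroup.isSubgroup G₁◁G)) G₁-onto
  where
  open Group G using (_∙_; _⁻¹)
  open QuotientAbelianGroup G (IsNormalSubgroup.isSubgroup G₂◁G) G/G₂-abelian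
  open AbelianGroupProperties quotient
  open CosetReps reps
  open SetoidReasoning ≈ᴺ-setoid

  G/G₂ : Group _ _
  G/G₂ = AbelianGroup.group quotient

  G₁-onto : ∀ w → ∃ λ h → G₁ h × h ≈ᴺ w
  G₁-onto w with zpow-surjective (order·≈ε rep covers distinct) (m - 1ℤ) m-1⊥n w
  ... | g , g^[m-1]≈ᴺw = g ⁻¹ ∙ α g , α-trivial-mod-G₁ g , (begin
    g ⁻¹ ∙ α g              ≈⟨ ∙-congˡᴺ (α-power-mod-G₂ g) ⟨
    g ⁻¹ ∙ zpow G g m       ≡⟨ ≡.cong (g ⁻¹ ∙_) (zpow-quotient g m) ⟩
    g ⁻¹ ∙ zpow G/G₂ g m    ≈⟨ zpow-pred g m ⟩
    zpow G/G₂ g (m - 1ℤ)    ≈⟨ g^[m-1]≈ᴺw ⟩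
    w                       ∎)
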